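{- For $n\geq 2$, $|\hat{\mathcal{B}}_n(122)|=2^{n-2}$.
   Context: An endofunction of size $n$ is a word $x=x_1\cdots x_n$ with entries in $\{1,\dots,n\}$; it is a Cayley permutation if it contains every integer between $1$ and $\max(x)$. Let $\mathrm{Ascbot}(x)=\{1\}\cup\{i:1\leq i\leq n-1,\ x_i<x_{i+1}\}$ and $\mathrm{Nub}(x)$ the set of indices $i$ such that $x_i$ is the leftmost occurrence of its value. A revised ascent sequence of length $n$ is a Cayley permutation $x$ of length $n$ with $\mathrm{Ascbot}(x)=\mathrm{Nub}(x)$. For Cayley permutations $x$ and $\sigma=\sigma_1\cdots\sigma_k$, $x$ contains $\sigma$ if there are indices $i_1<\cdots<i_k$ such that for all $s,t$: $x_{i_s}<x_{i_t}\iff\sigma_s<\sigma_t$ and $x_{i_s}=x_{i_t}\iff\sigma_s=\sigma_t$; otherwise $x$ avoids $\sigma$. $\hat{\mathcal{B}}_n(\sigma)$ is the set of revised ascent sequences of length $n$ avoiding $\sigma$. -}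

module Defs where

open import Data.Nat using (ℕ; zero; suc; _≤_; _<_; _⊔_)
open import Data.Fin using (Fin; toℕ)
open import Data.Vec using (Vec; lookup; foldr′; _∷_; [])
open import Data.List using (List; length)
open import Data.List.Membership.Propositional using (_∈_)
open import Data.List.Relation.Unary.Unique.Propositional using (Unique)
open import Data.Product using (Σ; ∃; ∃-syntax; _×_)
open import Data.Sum using (_⊎_)
open import Relation.Binary.PropositionalEquality using (_≡_; _≢_)
open import Function.Bundles using (_⇔_)

-- Words of length n are vectors x : Vec ℕ n; position i (0-based Fin n)
-- corresponds to the paper's 1-based position toℕ i + 1.

Endofunction : {n : ℕ} → Vec ℕ n → Set
Endofunction {n} x = ∀ (i : Fin n) → 1 ≤ lookup x i × lookup x i ≤ n

maxW : {n : ℕ} → Vec ℕ n → ℕ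
maxW = foldr′ _⊔_ 0

Cayley : {n : ℕ} → Vec ℕ n → Set
Cayley {n} x = Endofunction x ×
  (∀ (v : ℕ) → 1 ≤ v → v ≤ maxW x → ∃[ i ] lookup x i ≡ v)

InAscbot : {n : ℕ} → Vec ℕ n → Fin n → Set
InAscbot {n} x i =
  toℕ i ≡ 0 ⊎ (∃[ j ] (toℕ j ≡ suc (toℕ i) × lookup x i < lookup x j))

InNub : {n : ℕ} → Vec ℕ n → Fin n → Set
InNub {n} x i = ∀ (j : Fin n) → toℕ j < toℕ i → lookup x j ≢ lookup x i

RevisedAscent : {n : ℕ} → Vec ℕ n → Set
RevisedAscent {n} x = Cayley x × (∀ (i : Fin n) → InAscbot x i ⇔ InNub x i)

Contains : {k n : ℕ} → Vec ℕ k → Vec ℕ n → Set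
Contains {k} {n} σ x =
  Σ (Fin k → Fin n) λ f →
    (∀ (s t : Fin k) → toℕ s < toℕ t → toℕ (f s) < toℕ (f t)) ×
    (∀ (s t : Fin k) →
       ((lookup x (f s) < lookup x (f t)) ⇔ (lookup σ s < lookup σ t)) ×
       ((lookup x (f s) ≡ lookup x (f t)) ⇔ (lookup σ s ≡ lookup σ t)))

Avoids : {k n : ℕ} → Vec ℕ k → Vec ℕ n → Set
Avoids σ x = Contains σ x → Data.Empty.⊥
  where import Data.Empty

p122 : Vec ℕ 3
p122 = 1 ∷ 2 ∷ 2 ∷ []

BHat : (n : ℕ) {k : ℕ} → Vec ℕ k → Vec ℕ n → Set
BHat n σ x = RevisedAscent x × Avoids σ x

HasCardinality : {A : Set} → (A → Set) → ℕ → Set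
HasCardinality {A} P m =
  Σ (List A) λ L → Unique L × (∀ (a : A) → (a ∈ L) ⇔ P a) × length L ≡ m

{-# OPTIONS --safe #-}
-- A revised ascent sequence has its maximum in front: an entry larger than all earlier ones
-- is a new value, hence the bottom of an ascent, which leads to a still larger entry, and so on
-- until the word ends.  Avoiding 122 moreover forbids repeating a value above any earlier
-- entry, which forces every such sequence of length at least 2 into the form
--   (s+d) s (s+1) … (s+d−1) (s+d) y,   all entries of y at most s,
-- and a word of this form is a 122-avoiding revised ascent sequence exactly when s y is one.
-- So the sequences of length m+3 arise, each exactly once, from those of length m+2 either by
-- doubling the first entry (d = 0) or by lengthening the run s … s+d by one entry: starting
-- from 1 1, their number doubles with each length.
module Submission where

open import Defs
open import Level using (0ℓ)
open import Data.Empty using (⊥; ⊥-elim)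
open import Data.Unit using (⊤; tt)
open import Data.Nat
open import Data.Nat.Properties
open import Data.Fin using (Fin; zero; suc; toℕ)
open import Data.Fin.Properties using (∀-cons-⇔)
open import Data.Vec using (Vec; []; _∷_; lookup; toList; fromList)
open import Data.Vec.Properties using (toList-injective; cast-is-id; toList∘fromList; length-toList)
open import Data.Vec.Membership.Propositional.Properties using (∈-lookup; ∈-toList⁺; ∈-toList⁻)
import Data.Vec.Relation.Unary.Any as VecAny
open import Data.Vec.Relation.Unary.Any.Properties using (lookup-index)
open import Data.List using (List; []; _∷_; _++_; length; map)
import Data.List.Properties as List
open import Data.List.Membership.Propositional using (_∈_; _∉_)
open import Data.List.Membership.Propositional.Properties using (∈-++⁻; ∈-++⁺ˡ; ∈-++⁺ʳ; ∈-map⁺; ∈-map⁻)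
open import Data.List.Relation.Unary.All as All using (All; []; _∷_)
open import Data.List.Relation.Unary.Any using (here; there)
open import Data.List.Relation.Unary.AllPairs using ([]; _∷_)
open import Data.List.Relation.Unary.Unique.Propositional using (Unique)
import Data.List.Relation.Unary.Unique.Propositional.Properties as Unique
open import Data.Product using (∃-syntax; _×_; _,_; proj₁; proj₂)
open import Data.Sum using (_⊎_; inj₁; inj₂; [_,_]′)
open import Function.Bundles using (_⇔_; mk⇔; Equivalence)
open import Function.Construct.Identity using (⇔-id)
open import Function.Construct.Symmetry using (⇔-sym)
open import Function.Construct.Composition using (_⇔-∘_)
open import Function.Related.TypeIsomorphisms using (¬-cong-⇔)
open import Data.Product.Function.NonDependent.Propositional using (_×-⇔_)
open import Data.Sum.Function.Propositional using (_⊎-⇔_)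
open import Function.Base using (id; _∘_)
open import Relation.Nullary using (¬_; yes; no)
open import Relation.Unary using (Pred; ｛_｝; _∪_)
open import Relation.Binary.PropositionalEquality

open Equivalence using (to; from)

known×⇔ : ∀ {A B : Set} → A → (A × B) ⇔ B
known×⇔ a = mk⇔ proj₂ (a ,_)

⇔-cong : ∀ {A A′ B B′ : Set} → A ⇔ A′ → B ⇔ B′ → (A ⇔ B) ⇔ (A′ ⇔ B′)
⇔-cong A⇔A′ B⇔B′ = mk⇔ (λ A⇔B → B⇔B′ ⇔-∘ (A⇔B ⇔-∘ ⇔-sym A⇔A′))
                        (λ A′⇔B′ → ⇔-sym B⇔B′ ⇔-∘ (A′⇔B′ ⇔-∘ A⇔A′))

Π-⇔ : ∀ {I : Set} {A B : I → Set} → (∀ i → A i ⇔ B i) → (∀ i → A i) ⇔ (∀ i → B i)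
Π-⇔ A⇔B = mk⇔ (λ a i → to (A⇔B i) (a i)) (λ b i → from (A⇔B i) (b i))

-- 122-avoiding revised ascent sequences as lists

Ascends : ℕ → List ℕ → Set
Ascends a []      = ⊥
Ascends a (b ∷ _) = a < b

-- seen holds the values occurring before the list; the first position of a
-- word is in both Ascbot and Nub, so only the later positions are constrained.
AscbotIsNubAfter : (seen : Pred ℕ 0ℓ) → List ℕ → Set
AscbotIsNubAfter seen []      = ⊤
AscbotIsNubAfter seen (a ∷ r) = (Ascends a r ⇔ (¬ seen a)) × AscbotIsNubAfter (｛ a ｝ ∪ seen) r

AscbotIsNub : List ℕ → Set
AscbotIsNub []      = ⊤
AscbotIsNub (a ∷ r) = AscbotIsNubAfter ｛ a ｝ r

NoRepeatAbove : ℕ → List ℕ → Set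
NoRepeatAbove a []      = ⊤
NoRepeatAbove a (b ∷ r) = (a < b → b ∉ r) × NoRepeatAbove a r

Avoids122 : List ℕ → Set
Avoids122 []      = ⊤
Avoids122 (a ∷ r) = NoRepeatAbove a r × Avoids122 r

Gapless : List ℕ → Set
Gapless l = ∀ {u} → u ∈ l → ∀ v → 1 ≤ v → v ≤ u → v ∈ l

-- The bound x_i ≤ n of an endofunction is not included: it holds for the generated lists.
record RevisedAscent122 (l : List ℕ) : Set where
  constructor revised
  field
    positive  : All (1 ≤_) l
    gapless   : Gapless l
    ascbotNub : AscbotIsNub l
    avoids    : Avoids122 l

run : ℕ → ℕ → List ℕ
run a zero    = []
run a (suc k) = a ∷ run (suc a) k

expand : ℕ → ℕ → List ℕ → List ℕ
expand s d y = s + d ∷ run s d ++ s + d ∷ y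

IncreasingFrom : ℕ → List ℕ → Set
IncreasingFrom m []      = ⊤
IncreasingFrom m (a ∷ l) = m < a × IncreasingFrom a l

-- The form of a sequence

∈-run⁻ : ∀ a k {v} → v ∈ run a k → a ≤ v × v < a + k
∈-run⁻ a (suc k) (here refl) = ≤-refl , m<m+n a (s≤s z≤n)
∈-run⁻ a (suc k) {v} (there v∈) with ∈-run⁻ (suc a) k v∈
... | a<v , v<1+a+k = <⇒≤ a<v , subst (v <_) (sym (+-suc a k)) v<1+a+k

∈-run⁺ : ∀ a k {v} → a ≤ v → v < a + k → v ∈ run a k
∈-run⁺ a zero {v} a≤v v<a+0 = ⊥-elim (<⇒≱ (subst (v <_) (+-identityʳ a) v<a+0) a≤v)
∈-run⁺ a (suc k) {v} a≤v v<a+1+k with a ≟ v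
... | yes refl = here refl
... | no a≢v = there (∈-run⁺ (suc a) k (≤∧≢⇒< a≤v a≢v) (subst (v <_) (+-suc a k) v<a+1+k))

length-run : ∀ a k → length (run a k) ≡ k
length-run a zero    = refl
length-run a (suc k) = cong suc (length-run (suc a) k)

run-∷ʳ : ∀ a k z → run a (suc k) ++ z ≡ run a k ++ a + k ∷ z
run-∷ʳ a zero z    = cong (_∷ z) (sym (+-identityʳ a))
run-∷ʳ a (suc k) z =
  cong (a ∷_) (trans (run-∷ʳ (suc a) k z) (cong (λ w → run (suc a) k ++ w ∷ z) (sym (+-suc a k))))

IncreasingFrom⇒< : ∀ {m} l {v} → IncreasingFrom m l → v ∈ l → m < v
IncreasingFrom⇒< (a ∷ l) (m<a , _) (here refl)  = m<a
IncreasingFrom⇒< (a ∷ l) (m<a , inc) (there v∈) = <-trans m<a (IncreasingFrom⇒< l inc v∈)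

¬Ascends-into : ∀ {a b t} → b ≤ a → All (_≤ b) t → ¬ Ascends a t
¬Ascends-into b≤a (c≤b ∷ _) a<c = <-irrefl refl (<-≤-trans a<c (≤-trans c≤b b≤a))

-- The last entry above b would be new, hence the bottom of an ascent to an even larger entry.
all≤-if-unrepeated : ∀ {seen} b t → AscbotIsNubAfter seen t → NoRepeatAbove b t →
                     (∀ u → seen u → b < u → u ∉ t) → All (_≤ b) t
all≤-if-unrepeated b [] _ _ _ = []
all≤-if-unrepeated {seen} b (e ∷ t) (ascends⇔new , an) (e-unrepeated , nr) unseen
  with all≤-if-unrepeated b t an nr unseen′ | e ≤? b
  where
  unseen′ : ∀ u → (｛ e ｝ ∪ seen) u → b < u → u ∉ t
  unseen′ u (inj₁ refl) b<u = e-unrepeated b<u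
  unseen′ u (inj₂ seen-u) b<u u∈t = unseen u seen-u b<u (there u∈t)
... | t≤b | yes e≤b = e≤b ∷ t≤b
... | t≤b | no e≰b  = ⊥-elim (¬Ascends-into (<⇒≤ b<e) t≤b (from ascends⇔new e-new))
  where
  b<e : b < e
  b<e = ≰⇒> e≰b
  e-new : ¬ seen e
  e-new seen-e = unseen e seen-e b<e (here refl)

head-max : ∀ {s r} → RevisedAscent122 (s ∷ r) → All (_≤ s) r
head-max (revised _ _ an (nr , _)) =
  all≤-if-unrepeated _ _ an nr λ { _ refl s<u _ → <-irrefl refl s<u }

-- Entries above b are new until the value s appears, so up to there r keeps ascending.
climb : ∀ {seen} b s m r → AscbotIsNubAfter seen r → NoRepeatAbove b r →
        (∀ u → seen u → b < u → u ≢ s → u ∉ r) → b ≤ m → Ascends m r →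
        ∃[ c ] ∃[ y ] r ≡ c ++ s ∷ y × IncreasingFrom m (c ++ s ∷ []) × All (_≤ b) y
climb {seen} b s m (a ∷ r) (ascends⇔new , an) (a-unrepeated , nr) unseen b≤m m<a with a ≟ s
... | yes refl = [] , r , refl , (m<a , tt) , all≤-if-unrepeated b r an nr unseen′
  where
  unseen′ : ∀ u → (｛ a ｝ ∪ seen) u → b < u → u ∉ r
  unseen′ u (inj₁ refl) b<u = a-unrepeated b<u
  unseen′ u (inj₂ seen-u) b<u u∈r with u ≟ a
  ... | yes refl = a-unrepeated b<u u∈r
  ... | no u≢a   = unseen u seen-u b<u u≢a (there u∈r)
... | no a≢s with climb b s a r an nr unseen′ (<⇒≤ b<a) (from ascends⇔new a-new)
  where
  b<a : b < a
  b<a = ≤-<-trans b≤m m<a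
  a-new : ¬ seen a
  a-new seen-a = unseen a seen-a b<a a≢s (here refl)
  unseen′ : ∀ u → (｛ a ｝ ∪ seen) u → b < u → u ≢ s → u ∉ r
  unseen′ u (inj₁ refl) b<u _ = a-unrepeated b<u
  unseen′ u (inj₂ seen-u) b<u u≢s u∈r = unseen u seen-u b<u u≢s (there u∈r)
... | c , y , refl , increasing , y≤b = a ∷ c , y , refl , (m<a , increasing) , y≤b

increasing-gapless⇒run : ∀ c m s → IncreasingFrom m (c ++ s ∷ []) → (∀ v → m < v → v < s → v ∈ c) →
                         c ≡ run (suc m) (length c) × s ≡ suc m + length c
increasing-gapless⇒run [] m s (m<s , _) between with suc m ≟ s
... | yes refl = refl , cong suc (sym (+-identityʳ m))
... | no 1+m≢s with between (suc m) ≤-refl (≤∧≢⇒< m<s 1+m≢s)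
... | ()
increasing-gapless⇒run (a ∷ c) m s (m<a , increasing) between with suc m ≟ a
... | no 1+m≢a = ⊥-elim (1+m∉ (between (suc m) ≤-refl (<-trans 1+m<a a<s)))
  where
  1+m<a : suc m < a
  1+m<a = ≤∧≢⇒< m<a 1+m≢a
  a<s : a < s
  a<s = IncreasingFrom⇒< (c ++ s ∷ []) increasing (∈-++⁺ʳ c (here refl))
  1+m∉ : suc m ∉ a ∷ c
  1+m∉ (here 1+m≡a) = 1+m≢a 1+m≡a
  1+m∉ (there 1+m∈c) = <-asym 1+m<a (IncreasingFrom⇒< (c ++ s ∷ []) increasing (∈-++⁺ˡ 1+m∈c))
... | yes refl with increasing-gapless⇒run c a s increasing between′
  where
  between′ : ∀ v → a < v → v < s → v ∈ c
  between′ v a<v v<s with between v (<-trans (n<1+n m) a<v) v<s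
  ... | here refl = ⊥-elim (<-irrefl refl a<v)
  ... | there v∈c = v∈c
... | c≡run , s≡ = cong (a ∷_) c≡run , trans s≡ (sym (+-suc (suc m) (length c)))

expand-form : ∀ {s c} → RevisedAscent122 (s ∷ c) → c ≢ [] →
        ∃[ t ] ∃[ d ] ∃[ y ] s ∷ c ≡ expand t d y × All (_≤ t) y
expand-form {c = []} _ c≢[] = ⊥-elim (c≢[] refl)
expand-form {s} {t ∷ r} valid@(revised pos gap (ascends⇔new , an) (_ , nr , _)) _ with t ≟ s | head-max valid
... | yes refl | _ ∷ r≤t = t , 0 , r , cong (λ w → w ∷ w ∷ r) (sym (+-identityʳ t)) , r≤t
... | no t≢s | t≤s ∷ _
  with climb t s t r an nr unseen ≤-refl (from ascends⇔new λ s≡t → t≢s (sym s≡t))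
  where
  unseen : ∀ u → (｛ t ｝ ∪ ｛ s ｝) u → t < u → u ≢ s → u ∉ r
  unseen u (inj₁ refl) t<u _ = ⊥-elim (<-irrefl refl t<u)
  unseen u (inj₂ refl) _ u≢s = ⊥-elim (u≢s refl)
... | c , y , refl , increasing , y≤t with increasing-gapless⇒run c t s increasing between
  where
  between : ∀ v → t < v → v < s → v ∈ c
  between v t<v v<s with gap (here refl) v (≤-trans (All.head pos′) (<⇒≤ t<v)) (<⇒≤ v<s)
    where pos′ = All.tail pos
  ... | here refl = ⊥-elim (<-irrefl refl v<s)
  ... | there (here refl) = ⊥-elim (<-irrefl refl t<v)
  ... | there (there v∈) with ∈-++⁻ c v∈
  ...   | inj₁ v∈c = v∈c
  ...   | inj₂ (here refl) = ⊥-elim (<-irrefl refl v<s)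
  ...   | inj₂ (there v∈y) = ⊥-elim (<-irrefl refl (<-≤-trans t<v (All.lookup y≤t v∈y)))
... | c≡run , s≡ = t , suc (length c) , y , is-expand , y≤t
  where
  is-expand : s ∷ t ∷ c ++ s ∷ y ≡ expand t (suc (length c)) y
  is-expand rewrite s≡ | sym (+-suc t (length c)) | sym c≡run = refl

-- Expanding the first entry into a run

∈-expand⁻ : ∀ s d y {v} → v ∈ expand s d y → (s ≤ v × v ≤ s + d) ⊎ v ∈ y
∈-expand⁻ s d y (here refl) = inj₁ (m≤m+n s d , ≤-refl)
∈-expand⁻ s d y (there v∈) with ∈-++⁻ (run s d) v∈
... | inj₁ v∈run with ∈-run⁻ s d v∈run
...   | s≤v , v<s+d = inj₁ (s≤v , <⇒≤ v<s+d)
∈-expand⁻ s d y (there v∈) | inj₂ (here refl) = inj₁ (m≤m+n s d , ≤-refl)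
∈-expand⁻ s d y (there v∈) | inj₂ (there v∈y) = inj₂ v∈y

∈-expand⁺ : ∀ s d y {v} → (s ≤ v × v ≤ s + d) ⊎ v ∈ y → v ∈ expand s d y
∈-expand⁺ s d y {v} (inj₁ (s≤v , v≤s+d)) with v ≟ s + d
... | yes refl = here refl
... | no v≢s+d = there (∈-++⁺ˡ (∈-run⁺ s d s≤v (≤∧≢⇒< v≤s+d v≢s+d)))
∈-expand⁺ s d y (inj₂ v∈y) = there (∈-++⁺ʳ (run s d) (there v∈y))

expand-all≤ : ∀ s d y → All (_≤ s) y → All (_≤ s + d) (expand s d y)
expand-all≤ s d y y≤s = All.tabulate λ v∈ →
  [ proj₂ , (λ v∈y → ≤-trans (All.lookup y≤s v∈y) (m≤m+n s d)) ]′ (∈-expand⁻ s d y v∈)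

expand-positive⇔ : ∀ s d y → All (1 ≤_) (expand s d y) ⇔ All (1 ≤_) (s ∷ y)
expand-positive⇔ s d y = mk⇔
  (λ pos → All.lookup pos (∈-expand⁺ s d y (inj₁ (≤-refl , m≤m+n s d))) ∷
           All.tabulate λ v∈y → All.lookup pos (∈-expand⁺ s d y (inj₂ v∈y)))
  (λ { (1≤s ∷ pos) → All.tabulate λ v∈ →
         [ (λ (s≤v , _) → ≤-trans 1≤s s≤v) , All.lookup pos ]′ (∈-expand⁻ s d y v∈) })

expand-gapless⇔ : ∀ s d y → All (_≤ s) y → Gapless (expand s d y) ⇔ Gapless (s ∷ y)
expand-gapless⇔ s d y y≤s = mk⇔ shrink enlarge
  where
  s∈ : s ∈ expand s d y
  s∈ = ∈-expand⁺ s d y (inj₁ (≤-refl , m≤m+n s d))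
  shrink : Gapless (expand s d y) → Gapless (s ∷ y)
  shrink gap {u} u∈ v 1≤v v≤u with ∈-expand⁻ s d y (gap (∈-expand u∈) v 1≤v v≤u)
    where
    ∈-expand : ∀ {u} → u ∈ s ∷ y → u ∈ expand s d y
    ∈-expand (here refl)  = s∈
    ∈-expand (there u∈y) = ∈-expand⁺ s d y (inj₂ u∈y)
  ... | inj₂ v∈y = there v∈y
  ... | inj₁ (s≤v , _) with ≤-antisym s≤v (≤-trans v≤u (All.lookup (≤-refl ∷ y≤s) u∈))
  ...   | refl = here refl
  enlarge : Gapless (s ∷ y) → Gapless (expand s d y)
  enlarge gap {u} u∈ v 1≤v v≤u with s ≤? v
  ... | yes s≤v = ∈-expand⁺ s d y (inj₁ (s≤v , ≤-trans v≤u (All.lookup (expand-all≤ s d y y≤s) u∈)))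
  ... | no s≰v with gap (here refl) v 1≤v (<⇒≤ (≰⇒> s≰v))
  ...   | here refl = ⊥-elim (s≰v ≤-refl)
  ...   | there v∈y = ∈-expand⁺ s d y (inj₂ v∈y)

AscbotIsNubAfter-cong : ∀ {seen seen′ b} y → All (_≤ b) y → (∀ {v} → v ≤ b → seen v ⇔ seen′ v) →
                        AscbotIsNubAfter seen y ⇔ AscbotIsNubAfter seen′ y
AscbotIsNubAfter-cong [] _ _ = ⇔-id _
AscbotIsNubAfter-cong (a ∷ r) (a≤b ∷ r≤b) agree =
  ⇔-cong (⇔-id _) (¬-cong-⇔ (agree a≤b))
  ×-⇔ AscbotIsNubAfter-cong r r≤b (λ v≤b → ⇔-id _ ⊎-⇔ agree v≤b)

Ascends-run : ∀ a k y → Ascends a (run (suc a) k ++ suc a + k ∷ y)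
Ascends-run a zero y    = s≤s (≤-reflexive (sym (+-identityʳ a)))
Ascends-run a (suc k) y = ≤-refl

AscbotIsNubAfter-run : ∀ {seen seen′ b} a k t y → t ≡ a + k → All (_≤ b) y → b ≤ a →
                       (∀ v → a ≤ v → v < t → ¬ seen v) → seen t →
                       (∀ {v} → v ≤ b → seen′ v ⇔ (a ≡ v ⊎ seen v)) →
                       AscbotIsNubAfter seen (run a k ++ t ∷ y) ⇔ AscbotIsNubAfter seen′ y
AscbotIsNubAfter-run a zero t y t≡a+0 y≤b b≤a _ seen-t agree with trans t≡a+0 (+-identityʳ a)
... | refl = ⇔-sym (AscbotIsNubAfter-cong y y≤b agree) ⇔-∘ known×⇔ t-stays-seen
  where
  t-stays-seen = mk⇔ (λ ascends → ⊥-elim (¬Ascends-into b≤a y≤b ascends)) (λ t-new → ⊥-elim (t-new seen-t))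
AscbotIsNubAfter-run {seen} {seen′} {b} a (suc k) t y t≡ y≤b b≤a unseen seen-t agree =
  AscbotIsNubAfter-run (suc a) k t y t≡1+a+k y≤b (≤-trans b≤a (n≤1+n a)) unseen′ (inj₂ seen-t) agree′
  ⇔-∘ known×⇔ (mk⇔ (λ _ → a-new) (λ _ → a-ascends))
  where
  t≡1+a+k : t ≡ suc a + k
  t≡1+a+k = trans t≡ (+-suc a k)
  a-new : ¬ seen a
  a-new = unseen a ≤-refl (subst (a <_) (sym t≡1+a+k) (s≤s (m≤m+n a k)))
  a-ascends : Ascends a (run (suc a) k ++ t ∷ y)
  a-ascends = subst (λ w → Ascends a (run (suc a) k ++ w ∷ y)) (sym t≡1+a+k) (Ascends-run a k y)
  unseen′ : ∀ v → suc a ≤ v → v < t → ¬ (｛ a ｝ ∪ seen) v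
  unseen′ v 1+a≤v _ (inj₁ refl) = <-irrefl refl 1+a≤v
  unseen′ v 1+a≤v v<t (inj₂ seen-v) = unseen v (<⇒≤ 1+a≤v) v<t seen-v
  agree′ : ∀ {v} → v ≤ b → seen′ v ⇔ (suc a ≡ v ⊎ (｛ a ｝ ∪ seen) v)
  agree′ v≤b = mk⇔ (λ seen′-v → inj₂ (to (agree v≤b) seen′-v))
                   [ (λ { refl → ⊥-elim (<-irrefl refl (≤-trans v≤b b≤a)) }) , from (agree v≤b) ]′

expand-ascbotNub⇔ : ∀ s d y → All (_≤ s) y → AscbotIsNub (expand s d y) ⇔ AscbotIsNub (s ∷ y)
expand-ascbotNub⇔ s d y y≤s =
  AscbotIsNubAfter-run {seen′ = ｛ s ｝} s d (s + d) y refl y≤s ≤-refl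
    (λ v _ v<s+d s+d≡v → <-irrefl (sym s+d≡v) v<s+d) refl agree
  where
  agree : ∀ {v} → v ≤ s → s ≡ v ⇔ (s ≡ v ⊎ s + d ≡ v)
  agree v≤s = mk⇔ inj₁ [ id , (λ s+d≡v → ≤-antisym (≤-trans (m≤m+n s d) (≤-reflexive s+d≡v)) v≤s) ]′

NoRepeatAbove-all≤ : ∀ {a} y → All (_≤ a) y → NoRepeatAbove a y
NoRepeatAbove-all≤ [] []                = tt
NoRepeatAbove-all≤ (b ∷ y) (b≤a ∷ y≤a) = (λ a<b _ → <⇒≱ a<b b≤a) , NoRepeatAbove-all≤ y y≤a

NoRepeatAbove-run : ∀ {a} a′ k t y → t ≡ a′ + k → All (_≤ a) y → NoRepeatAbove a (run a′ k ++ t ∷ y)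
NoRepeatAbove-run a′ zero t y _ y≤a = (λ a<t t∈y → <⇒≱ a<t (All.lookup y≤a t∈y)) , NoRepeatAbove-all≤ y y≤a
NoRepeatAbove-run {a} a′ (suc k) t y t≡ y≤a = a′-unrepeated , NoRepeatAbove-run (suc a′) k t y t≡1+a′+k y≤a
  where
  t≡1+a′+k : t ≡ suc a′ + k
  t≡1+a′+k = trans t≡ (+-suc a′ k)
  a′-unrepeated : a < a′ → a′ ∉ run (suc a′) k ++ t ∷ y
  a′-unrepeated a<a′ a′∈ with ∈-++⁻ (run (suc a′) k) a′∈
  ... | inj₁ a′∈run        = <-irrefl refl (proj₁ (∈-run⁻ (suc a′) k a′∈run))
  ... | inj₂ (here a′≡t)   = <-irrefl (trans a′≡t t≡1+a′+k) (s≤s (m≤m+n a′ k))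
  ... | inj₂ (there a′∈y) = <⇒≱ a<a′ (All.lookup y≤a a′∈y)

Avoids122-run : ∀ a k t y → t ≡ a + k → All (_≤ a) y → Avoids122 (run a k ++ t ∷ y) ⇔ Avoids122 (t ∷ y)
Avoids122-run a zero t y _ _ = ⇔-id _
Avoids122-run a (suc k) t y t≡ y≤a =
  Avoids122-run (suc a) k t y t≡1+a+k (All.map m≤n⇒m≤1+n y≤a)
  ⇔-∘ known×⇔ (NoRepeatAbove-run (suc a) k t y t≡1+a+k y≤a)
  where
  t≡1+a+k : t ≡ suc a + k
  t≡1+a+k = trans t≡ (+-suc a k)

expand-avoids⇔ : ∀ s d y → All (_≤ s) y → Avoids122 (expand s d y) ⇔ Avoids122 (s ∷ y)
expand-avoids⇔ s d y y≤s =
  ⇔-sym (known×⇔ (NoRepeatAbove-all≤ y y≤s))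
  ⇔-∘ (known×⇔ (NoRepeatAbove-all≤ y y≤s+d)
  ⇔-∘ (Avoids122-run s d (s + d) y refl y≤s
  ⇔-∘ known×⇔ (NoRepeatAbove-all≤ _ (All.tail (expand-all≤ s d y y≤s)))))
  where
  y≤s+d : All (_≤ s + d) y
  y≤s+d = All.map (λ v≤s → ≤-trans v≤s (m≤m+n s d)) y≤s

expand-valid⇔ : ∀ s d y → All (_≤ s) y → RevisedAscent122 (expand s d y) ⇔ RevisedAscent122 (s ∷ y)
expand-valid⇔ s d y y≤s = mk⇔
  (λ (revised pos gap an av) → revised (to P pos) (to G gap) (to A an) (to V av))
  (λ (revised pos gap an av) → revised (from P pos) (from G gap) (from A an) (from V av))
  where
  P = expand-positive⇔ s d y
  G = expand-gapless⇔ s d y y≤s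
  A = expand-ascbotNub⇔ s d y y≤s
  V = expand-avoids⇔ s d y y≤s

-- Generating the sequences of each length

insertAfter : ℕ → ℕ → List ℕ → List ℕ
insertAfter a b []      = b ∷ []
insertAfter a b (c ∷ l) with c ≟ a
... | yes _ = c ∷ b ∷ l
... | no _  = c ∷ insertAfter a b l

double : List ℕ → List ℕ
double []      = []
double (s ∷ c) = s ∷ s ∷ c

extend : List ℕ → List ℕ
extend []      = []
extend (s ∷ c) = suc s ∷ insertAfter s (suc s) c

generate : ℕ → List (List ℕ)
generate zero    = (1 ∷ 1 ∷ []) ∷ []
generate (suc m) = map double (generate m) ++ map extend (generate m)

length-insertAfter : ∀ a b l → length (insertAfter a b l) ≡ suc (length l)
length-insertAfter a b [] = refl
length-insertAfter a b (c ∷ l) with c ≟ a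
... | yes _ = refl
... | no _  = cong suc (length-insertAfter a b l)

insertAfter-∷ : ∀ a b e l → ∃[ r ] insertAfter a b (e ∷ l) ≡ e ∷ r
insertAfter-∷ a b e l with e ≟ a
... | yes _ = b ∷ l , refl
... | no _  = insertAfter a b l , refl

insertAfter-all : ∀ {P : Pred ℕ 0ℓ} a {b} l → P b → All P l → All P (insertAfter a b l)
insertAfter-all a [] pb [] = pb ∷ []
insertAfter-all a (c ∷ l) pb (pc ∷ pl) with c ≟ a
... | yes _ = pc ∷ pb ∷ pl
... | no _  = pc ∷ insertAfter-all a l pb pl

insertAfter-run : ∀ a k t b y → t ≡ a + k → insertAfter t b (run a k ++ t ∷ y) ≡ run a k ++ t ∷ b ∷ y
insertAfter-run a zero t b y _ with t ≟ t
... | yes _   = refl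
... | no t≢t = ⊥-elim (t≢t refl)
insertAfter-run a (suc k) t b y t≡ with a ≟ t
... | yes refl = ⊥-elim (<-irrefl t≡ (m<m+n a (s≤s z≤n)))
... | no _     = cong (a ∷_) (insertAfter-run (suc a) k t b y (trans t≡ (+-suc a k)))

double-expand : ∀ s y → double (s ∷ y) ≡ expand s 0 y
double-expand s y = cong (λ w → w ∷ w ∷ y) (sym (+-identityʳ s))

extend-expand : ∀ s d y → extend (expand s d y) ≡ expand s (suc d) y
extend-expand s d y = begin
  suc (s + d) ∷ insertAfter (s + d) (suc (s + d)) (run s d ++ s + d ∷ y)
    ≡⟨ cong (suc (s + d) ∷_) (insertAfter-run s d (s + d) _ y refl) ⟩
  suc (s + d) ∷ run s d ++ s + d ∷ suc (s + d) ∷ y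
    ≡⟨ cong (suc (s + d) ∷_) (sym (run-∷ʳ s d (suc (s + d) ∷ y))) ⟩
  suc (s + d) ∷ run s (suc d) ++ suc (s + d) ∷ y
    ≡⟨ cong (λ w → w ∷ run s (suc d) ++ w ∷ y) (sym (+-suc s d)) ⟩
  expand s (suc d) y ∎
  where open ≡-Reasoning

length-expand : ∀ s d y → length (expand s d y) ≡ suc d + length (s ∷ y)
length-expand s d y = cong suc (trans (List.length-++ (run s d)) (cong (_+ suc (length y)) (length-run s d)))

singleton-valid⇒1 : ∀ {s} → RevisedAscent122 (s ∷ []) → s ≡ 1
singleton-valid⇒1 (revised (1≤s ∷ []) gap _ _) with gap (here refl) 1 ≤-refl 1≤s
... | here 1≡s = sym 1≡s

[1]-valid : RevisedAscent122 (1 ∷ [])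
[1]-valid = revised (≤-refl ∷ []) gap tt (tt , tt)
  where
  gap : Gapless (1 ∷ [])
  gap (here refl) v 1≤v v≤1 with ≤-antisym v≤1 1≤v
  ... | refl = here refl

double-valid : ∀ {s c} → RevisedAscent122 (s ∷ c) → RevisedAscent122 (double (s ∷ c))
double-valid {s} {c} valid =
  subst RevisedAscent122 (sym (double-expand s c)) (from (expand-valid⇔ s 0 c (head-max valid)) valid)

extend-valid : ∀ {s e c} → RevisedAscent122 (s ∷ e ∷ c) → RevisedAscent122 (extend (s ∷ e ∷ c))
extend-valid valid with expand-form valid (λ ())
... | t , d , y , eq , y≤t =
  subst (RevisedAscent122 ∘ extend) (sym eq) (subst RevisedAscent122 (sym (extend-expand t d y))
    (from (expand-valid⇔ t (suc d) y y≤t) (to (expand-valid⇔ t d y y≤t) (subst RevisedAscent122 eq valid))))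

∈-generate⁻ : ∀ m {l} → l ∈ generate m → RevisedAscent122 l × length l ≡ 2 + m × All (_≤ 2 + m) l
∈-generate⁻ zero (here refl) = double-valid [1]-valid , refl , s≤s z≤n ∷ s≤s z≤n ∷ []
∈-generate⁻ (suc m) l∈ with ∈-++⁻ (map double (generate m)) l∈
... | inj₁ l∈doubles with ∈-map⁻ double l∈doubles
...   | [] , l′∈ , refl with ∈-generate⁻ m l′∈
...     | _ , () , _
∈-generate⁻ (suc m) l∈ | inj₁ _ | s ∷ c , l′∈ , refl with ∈-generate⁻ m l′∈
...     | valid , len , s≤ ∷ c≤ =
  double-valid valid , cong suc len , m≤n⇒m≤1+n s≤ ∷ m≤n⇒m≤1+n s≤ ∷ All.map m≤n⇒m≤1+n c≤
∈-generate⁻ (suc m) l∈ | inj₂ l∈extends with ∈-map⁻ extend l∈extends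
...   | [] , l′∈ , refl with ∈-generate⁻ m l′∈
...     | _ , () , _
∈-generate⁻ (suc m) l∈ | inj₂ _ | s ∷ [] , l′∈ , refl with ∈-generate⁻ m l′∈
...     | _ , () , _
∈-generate⁻ (suc m) l∈ | inj₂ _ | s ∷ e ∷ c , l′∈ , refl with ∈-generate⁻ m l′∈
...     | valid , len , s≤ ∷ ec≤ =
  extend-valid valid ,
  cong suc (trans (length-insertAfter s (suc s) (e ∷ c)) len) ,
  s≤s s≤ ∷ insertAfter-all s (e ∷ c) (s≤s s≤) (All.map m≤n⇒m≤1+n ec≤)

mutual
  ∈-generate⁺ : ∀ m {l} → RevisedAscent122 l → length l ≡ 2 + m → l ∈ generate m
  ∈-generate⁺ m {s ∷ c} valid len with expand-form valid (λ { refl → 0≢1+n (suc-injective len) })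
  ... | t , d , y , eq , y≤t =
    subst (_∈ generate m) (sym eq)
      (expand∈generate m d y≤t (to (expand-valid⇔ t d y y≤t) (subst RevisedAscent122 eq valid))
        (trans (cong length (sym eq)) len))

  expand∈generate : ∀ m d {t y} → All (_≤ t) y → RevisedAscent122 (t ∷ y) →
                    length (expand t d y) ≡ 2 + m → expand t d y ∈ generate m
  expand∈generate zero zero {y = []} _ valid _ rewrite singleton-valid⇒1 valid = here refl
  expand∈generate zero (suc d) {t} {y} _ _ len =
    ⊥-elim (m+1+n≢0 d (sym (suc-injective (suc-injective (trans (sym len) (length-expand t (suc d) y))))))
  expand∈generate (suc m) zero {t} {y} _ valid len =
    subst (_∈ generate (suc m)) (double-expand t y)
      (∈-++⁺ˡ (∈-map⁺ double (∈-generate⁺ m valid (suc-injective len))))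
  expand∈generate (suc m) (suc d) {t} {y} y≤t valid len =
    subst (_∈ generate (suc m)) (extend-expand t d y)
      (∈-++⁺ʳ (map double (generate m)) (∈-map⁺ extend (expand∈generate m d y≤t valid len′)))
    where
    len′ : length (expand t d y) ≡ 2 + m
    len′ = suc-injective (trans (cong suc (length-expand t d y)) (trans (sym (length-expand t (suc d) y)) len))

insertAfter-injective : ∀ a b {l l′} → insertAfter a b l ≡ insertAfter a b l′ → l ≡ l′
insertAfter-injective a b {l} {l′} eq = go l l′ (suc-injective same-length) eq
  where
  same-length : suc (length l) ≡ suc (length l′)
  same-length = trans (sym (length-insertAfter a b l)) (trans (cong length eq) (length-insertAfter a b l′))
  go : ∀ l l′ → length l ≡ length l′ → insertAfter a b l ≡ insertAfter a b l′ → l ≡ l′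
  go [] [] _ _ = refl
  go (c ∷ l) (c′ ∷ l′) len eq with c ≟ a | c′ ≟ a
  ... | yes _ | yes _ = cong₂ _∷_ (List.∷-injectiveˡ eq) (List.∷-injectiveʳ (List.∷-injectiveʳ eq))
  ... | no _  | no _  = cong₂ _∷_ (List.∷-injectiveˡ eq) (go l l′ (suc-injective len) (List.∷-injectiveʳ eq))
  ... | yes c≡a | no c′≢a = ⊥-elim (c′≢a (trans (sym (List.∷-injectiveˡ eq)) c≡a))
  ... | no c≢a  | yes c′≡a = ⊥-elim (c≢a (trans (List.∷-injectiveˡ eq) c′≡a))

double-injective : ∀ {l l′} → double l ≡ double l′ → l ≡ l′
double-injective {[]}    {[]}     _  = refl
double-injective {_ ∷ _} {_ ∷ _} eq = List.∷-injectiveʳ eq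

extend-injective : ∀ {l l′} → extend l ≡ extend l′ → l ≡ l′
extend-injective {[]}    {[]}     _  = refl
extend-injective {s ∷ c} {s′ ∷ c′} eq with suc-injective (List.∷-injectiveˡ eq)
... | refl = cong (s ∷_) (insertAfter-injective s (suc s) (List.∷-injectiveʳ eq))

double≢extend : ∀ s c t e c′ → e ≤ t → double (s ∷ c) ≢ extend (t ∷ e ∷ c′)
double≢extend s c t e c′ e≤t eq with insertAfter-∷ t (suc t) e c′
... | r , inserted = 1+n≰n (subst (_≤ t) (trans (sym s≡e) s≡1+t) e≤t)
  where
  eq′ : s ∷ s ∷ c ≡ suc t ∷ e ∷ r
  eq′ = trans eq (cong (suc t ∷_) inserted)
  s≡1+t : s ≡ suc t
  s≡1+t = List.∷-injectiveˡ eq′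
  s≡e : s ≡ e
  s≡e = List.∷-injectiveˡ (List.∷-injectiveʳ eq′)

generate-unique : ∀ m → Unique (generate m)
generate-unique zero    = [] ∷ []
generate-unique (suc m) =
  Unique.++⁺ (Unique.map⁺ double-injective (generate-unique m))
             (Unique.map⁺ extend-injective (generate-unique m)) disjoint
  where
  disjoint : ∀ {l} → ¬ (l ∈ map double (generate m) × l ∈ map extend (generate m))
  disjoint (l∈doubles , l∈extends) with ∈-map⁻ double l∈doubles | ∈-map⁻ extend l∈extends
  ... | l₁ , l₁∈ , eq₁ | l₂ , l₂∈ , eq₂ with ∈-generate⁻ m l₁∈ | ∈-generate⁻ m l₂∈
  ... | _ , _ , _ | valid₂ , _ , _ with l₁ | l₂
  ... | s ∷ c | t ∷ e ∷ c′ = double≢extend s c t e c′ (All.head (head-max valid₂)) (trans (sym eq₁) eq₂)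

length-generate : ∀ m → length (generate m) ≡ 2 ^ m
length-generate zero    = refl
length-generate (suc m) = begin
  length (map double (generate m) ++ map extend (generate m))
    ≡⟨ List.length-++ (map double (generate m)) ⟩
  length (map double (generate m)) + length (map extend (generate m))
    ≡⟨ cong₂ _+_ (List.length-map double (generate m)) (List.length-map extend (generate m)) ⟩
  length (generate m) + length (generate m)
    ≡⟨ cong (λ k → k + k) (length-generate m) ⟩
  2 ^ m + 2 ^ m
    ≡⟨ cong (2 ^ m +_) (sym (+-identityʳ (2 ^ m))) ⟩
  2 ^ suc m ∎
  where open ≡-Reasoning

-- From words to lists

lookup∈toList : ∀ {n} (x : Vec ℕ n) i → lookup x i ∈ toList x
lookup∈toList x i = ∈-toList⁺ (∈-lookup i x)

∈toList⇒lookup : ∀ {n} (x : Vec ℕ n) {v} → v ∈ toList x → ∃[ i ] lookup x i ≡ v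
∈toList⇒lookup x v∈ = VecAny.index (∈-toList⁻ v∈) , sym (lookup-index (∈-toList⁻ v∈))

All-toList⇔ : ∀ {n} {P : Pred ℕ 0ℓ} (x : Vec ℕ n) → All P (toList x) ⇔ (∀ i → P (lookup x i))
All-toList⇔ {P = P} x = mk⇔ (λ all i → All.lookup all (lookup∈toList x i))
  (λ p → All.tabulate λ v∈ → let i , xᵢ≡v = ∈toList⇒lookup x v∈ in subst P xᵢ≡v (p i))

lookup≤maxW : ∀ {n} (x : Vec ℕ n) i → lookup x i ≤ maxW x
lookup≤maxW (a ∷ x) zero    = m≤m⊔n a (maxW x)
lookup≤maxW (a ∷ x) (suc i) = ≤-trans (lookup≤maxW x i) (m≤n⊔m a (maxW x))

maxW∈ : ∀ {n} (x : Vec ℕ n) → maxW x ≡ 0 ⊎ maxW x ∈ toList x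
maxW∈ [] = inj₁ refl
maxW∈ (a ∷ x) with ⊔-sel a (maxW x)
... | inj₁ a⊔≡a = inj₂ (here a⊔≡a)
... | inj₂ a⊔≡max with maxW∈ x
...   | inj₁ max≡0  = inj₁ (trans a⊔≡max max≡0)
...   | inj₂ max∈x = inj₂ (there (subst (_∈ toList x) (sym a⊔≡max) max∈x))

Endofunction⇔ : ∀ {n} (x : Vec ℕ n) → Endofunction x ⇔ (All (1 ≤_) (toList x) × All (_≤ n) (toList x))
Endofunction⇔ x = mk⇔ (λ endo → from (All-toList⇔ x) (proj₁ ∘ endo) , from (All-toList⇔ x) (proj₂ ∘ endo))
                      (λ (pos , bounded) i → to (All-toList⇔ x) pos i , to (All-toList⇔ x) bounded i)

Cayley-values⇔Gapless : ∀ {n} (x : Vec ℕ n) →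
                         (∀ v → 1 ≤ v → v ≤ maxW x → ∃[ i ] lookup x i ≡ v) ⇔ Gapless (toList x)
Cayley-values⇔Gapless x = mk⇔ gapless cayley
  where
  gapless : (∀ v → 1 ≤ v → v ≤ maxW x → ∃[ i ] lookup x i ≡ v) → Gapless (toList x)
  gapless attained u∈ v 1≤v v≤u with ∈toList⇒lookup x u∈
  ... | i , refl with attained v 1≤v (≤-trans v≤u (lookup≤maxW x i))
  ...   | j , refl = lookup∈toList x j
  cayley : Gapless (toList x) → ∀ v → 1 ≤ v → v ≤ maxW x → ∃[ i ] lookup x i ≡ v
  cayley gap v 1≤v v≤max with maxW∈ x
  ... | inj₁ max≡0  = ⊥-elim (<⇒≱ 1≤v (≤-trans v≤max (≤-reflexive max≡0)))
  ... | inj₂ max∈x = ∈toList⇒lookup x (gap max∈x v 1≤v v≤max)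

AscendsAt : ∀ {n} → Vec ℕ n → Fin n → Set
AscendsAt x i = ∃[ j ] (toℕ j ≡ suc (toℕ i) × lookup x i < lookup x j)

NewAt : ∀ {n} → Pred ℕ 0ℓ → Vec ℕ n → Fin n → Set
NewAt seen x i = ¬ seen (lookup x i) × InNub x i

AscendsAt-zero⇔ : ∀ {n} a (x : Vec ℕ n) → AscendsAt (a ∷ x) zero ⇔ Ascends a (toList x)
AscendsAt-zero⇔ a x = mk⇔ ascends (ascendsAt x)
  where
  ascends : ∀ {n} {x : Vec ℕ n} → AscendsAt (a ∷ x) zero → Ascends a (toList x)
  ascends {x = b ∷ x} (suc zero , _ , a<b) = a<b
  ascendsAt : ∀ {n} (x : Vec ℕ n) → Ascends a (toList x) → AscendsAt (a ∷ x) zero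
  ascendsAt (b ∷ x) a<b = suc zero , refl , a<b

AscendsAt-suc⇔ : ∀ {n} {a} {x : Vec ℕ n} {i} → AscendsAt (a ∷ x) (suc i) ⇔ AscendsAt x i
AscendsAt-suc⇔ = mk⇔ (λ { (suc j , j≡ , lt) → j , suc-injective j≡ , lt })
                     (λ (j , j≡ , lt) → suc j , cong suc j≡ , lt)

InNub-suc⇔ : ∀ {n} {a} {x : Vec ℕ n} {i} → InNub (a ∷ x) (suc i) ⇔ NewAt ｛ a ｝ x i
InNub-suc⇔ = mk⇔ (λ nub → nub zero (s≤s z≤n) , λ j j<i → nub (suc j) (s≤s j<i))
                 (λ { (a≢ , _) zero _ → a≢ ; (_ , nub) (suc j) (s≤s j<i) → nub j j<i })

NewAt-suc⇔ : ∀ {n} {seen a} {x : Vec ℕ n} {i} → NewAt seen (a ∷ x) (suc i) ⇔ NewAt (｛ a ｝ ∪ seen) x i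
NewAt-suc⇔ = mk⇔ (λ (unseen , nub) → let a≢ , nub′ = to InNub-suc⇔ nub in [ a≢ , unseen ]′ , nub′)
                 (λ (new , nub′) → new ∘ inj₂ , from InNub-suc⇔ (new ∘ inj₁ , nub′))

AscbotIsNubAfter⇔ : ∀ {n} seen (x : Vec ℕ n) →
                    AscbotIsNubAfter seen (toList x) ⇔ (∀ i → AscendsAt x i ⇔ NewAt seen x i)
AscbotIsNubAfter⇔ seen [] = mk⇔ (λ _ ()) (λ _ → tt)
AscbotIsNubAfter⇔ seen (a ∷ x) =
  ∀-cons-⇔ ⇔-∘ (⇔-cong (⇔-sym (AscendsAt-zero⇔ a x)) new-at-zero
             ×-⇔ (Π-⇔ (λ _ → ⇔-cong (⇔-sym AscendsAt-suc⇔) (⇔-sym (NewAt-suc⇔ {seen = seen})))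
                  ⇔-∘ AscbotIsNubAfter⇔ (｛ a ｝ ∪ seen) x))
  where
  new-at-zero : (¬ seen a) ⇔ NewAt seen (a ∷ x) zero
  new-at-zero = mk⇔ (_, λ _ ()) proj₁

Ascbot⇔Nub⇔AscbotIsNub : ∀ {n} (x : Vec ℕ n) → (∀ i → InAscbot x i ⇔ InNub x i) ⇔ AscbotIsNub (toList x)
Ascbot⇔Nub⇔AscbotIsNub [] = mk⇔ (λ _ → tt) (λ _ ())
Ascbot⇔Nub⇔AscbotIsNub (a ∷ x) =
  ⇔-sym (AscbotIsNubAfter⇔ ｛ a ｝ x)
  ⇔-∘ (Π-⇔ (λ _ → ⇔-cong (AscendsAt-suc⇔ ⇔-∘ ascbot-suc) InNub-suc⇔)
  ⇔-∘ (known×⇔ first-position ⇔-∘ ⇔-sym ∀-cons-⇔))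
  where
  first-position : InAscbot (a ∷ x) zero ⇔ InNub (a ∷ x) zero
  first-position = mk⇔ (λ _ _ ()) (λ _ → inj₁ refl)
  ascbot-suc : ∀ {i} → InAscbot (a ∷ x) (suc i) ⇔ AscendsAt (a ∷ x) (suc i)
  ascbot-suc = mk⇔ [ (λ ()) , id ]′ inj₂

RepeatAbove : ∀ {n} → ℕ → Vec ℕ n → Set
RepeatAbove e x = ∃[ b ] ∃[ c ] toℕ b < toℕ c × e < lookup x b × lookup x b ≡ lookup x c

Occurs122 : ∀ {n} → Vec ℕ n → Set
Occurs122 x = ∃[ a ] ∃[ b ] ∃[ c ]
  toℕ a < toℕ b × toℕ b < toℕ c × lookup x a < lookup x b × lookup x b ≡ lookup x c

NoRepeatAbove⇔ : ∀ {n} e (x : Vec ℕ n) → NoRepeatAbove e (toList x) ⇔ (¬ RepeatAbove e x)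
NoRepeatAbove⇔ e x = mk⇔ (no-repeat x) (no-repeat⁻ x)
  where
  no-repeat : ∀ {n} (x : Vec ℕ n) → NoRepeatAbove e (toList x) → ¬ RepeatAbove e x
  no-repeat (f ∷ x) (f-unrepeated , _) (zero , suc c , _ , e<f , f≡xc) =
    f-unrepeated e<f (subst (_∈ toList x) (sym f≡xc) (lookup∈toList x c))
  no-repeat (f ∷ x) (_ , nr) (suc b , suc c , s≤s b<c , repeat) = no-repeat x nr (b , c , b<c , repeat)
  no-repeat⁻ : ∀ {n} (x : Vec ℕ n) → ¬ RepeatAbove e x → NoRepeatAbove e (toList x)
  no-repeat⁻ [] _ = tt
  no-repeat⁻ (f ∷ x) ¬repeat =
    (λ e<f f∈ → let c , xc≡f = ∈toList⇒lookup x f∈ in ¬repeat (zero , suc c , s≤s z≤n , e<f , sym xc≡f)) ,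
    no-repeat⁻ x λ (b , c , b<c , repeat) → ¬repeat (suc b , suc c , s≤s b<c , repeat)

Avoids122⇔ : ∀ {n} (x : Vec ℕ n) → Avoids122 (toList x) ⇔ (¬ Occurs122 x)
Avoids122⇔ x = mk⇔ (avoids x) (avoids⁻ x)
  where
  avoids : ∀ {n} (x : Vec ℕ n) → Avoids122 (toList x) → ¬ Occurs122 x
  avoids (e ∷ x) (nr , _) (zero , suc b , suc c , _ , s≤s b<c , occurrence) =
    to (NoRepeatAbove⇔ e x) nr (b , c , b<c , occurrence)
  avoids (e ∷ x) (_ , av) (suc a , suc b , suc c , s≤s a<b , s≤s b<c , occurrence) =
    avoids x av (a , b , c , a<b , b<c , occurrence)
  avoids⁻ : ∀ {n} (x : Vec ℕ n) → ¬ Occurs122 x → Avoids122 (toList x)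
  avoids⁻ [] _ = tt
  avoids⁻ (e ∷ x) ¬occurs =
    from (NoRepeatAbove⇔ e x)
      (λ (b , c , b<c , repeat) → ¬occurs (zero , suc b , suc c , s≤s z≤n , s≤s b<c , repeat)) ,
    avoids⁻ x λ (a , b , c , a<b , b<c , occurrence) → ¬occurs (suc a , suc b , suc c , s≤s a<b , s≤s b<c , occurrence)

SameOrder : ℕ → ℕ → ℕ → ℕ → Set
SameOrder u v u′ v′ = (u < v ⇔ u′ < v′) × (u ≡ v ⇔ u′ ≡ v′)

same-order-< : ∀ {u v u′ v′} → u < v → u′ < v′ → SameOrder u v u′ v′
same-order-< u<v u′<v′ =
  mk⇔ (λ _ → u′<v′) (λ _ → u<v) ,
  mk⇔ (λ u≡v → ⊥-elim (<-irrefl u≡v u<v)) (λ u′≡v′ → ⊥-elim (<-irrefl u′≡v′ u′<v′))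

same-order-> : ∀ {u v u′ v′} → v < u → v′ < u′ → SameOrder u v u′ v′
same-order-> v<u v′<u′ =
  mk⇔ (λ u<v → ⊥-elim (<-asym u<v v<u)) (λ u′<v′ → ⊥-elim (<-asym u′<v′ v′<u′)) ,
  mk⇔ (λ u≡v → ⊥-elim (<-irrefl (sym u≡v) v<u)) (λ u′≡v′ → ⊥-elim (<-irrefl (sym u′≡v′) v′<u′))

same-order-≡ : ∀ {u v u′ v′} → u ≡ v → u′ ≡ v′ → SameOrder u v u′ v′
same-order-≡ u≡v u′≡v′ =
  mk⇔ (λ u<v → ⊥-elim (<-irrefl u≡v u<v)) (λ u′<v′ → ⊥-elim (<-irrefl u′≡v′ u′<v′)) ,
  mk⇔ (λ _ → u′≡v′) (λ _ → u≡v)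

Contains122⇔ : ∀ {n} (x : Vec ℕ n) → Contains p122 x ⇔ Occurs122 x
Contains122⇔ {n} x = mk⇔ occurrence embedding
  where
  occurrence : Contains p122 x → Occurs122 x
  occurrence (f , increasing , order) =
    f zero , f (suc zero) , f (suc (suc zero)) ,
    increasing zero (suc zero) (s≤s z≤n) , increasing (suc zero) (suc (suc zero)) (s≤s (s≤s z≤n)) ,
    from (proj₁ (order zero (suc zero))) ≤-refl , from (proj₂ (order (suc zero) (suc (suc zero)))) refl
  embedding : Occurs122 x → Contains p122 x
  embedding (a , b , c , a<b , b<c , xa<xb , xb≡xc) = f , increasing , order
    where
    f : Fin 3 → Fin n
    f zero             = a
    f (suc zero)       = b
    f (suc (suc zero)) = c
    increasing : ∀ s t → toℕ s < toℕ t → toℕ (f s) < toℕ (f t)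
    increasing zero (suc zero) _             = a<b
    increasing zero (suc (suc zero)) _       = <-trans a<b b<c
    increasing (suc zero) (suc (suc zero)) _ = b<c
    increasing _ zero ()
    increasing (suc zero) (suc zero) (s≤s ())
    increasing (suc (suc zero)) (suc zero) (s≤s ())
    increasing (suc (suc zero)) (suc (suc zero)) (s≤s (s≤s ()))
    xa<xc : lookup x a < lookup x c
    xa<xc = subst (lookup x a <_) xb≡xc xa<xb
    order : ∀ s t → SameOrder (lookup x (f s)) (lookup x (f t)) (lookup p122 s) (lookup p122 t)
    order zero zero                         = same-order-≡ refl refl
    order zero (suc zero)                   = same-order-< xa<xb ≤-refl
    order zero (suc (suc zero))             = same-order-< xa<xc ≤-refl
    order (suc zero) zero                   = same-order-> xa<xb ≤-refl
    order (suc zero) (suc zero)             = same-order-≡ refl refl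
    order (suc zero) (suc (suc zero))       = same-order-≡ xb≡xc refl
    order (suc (suc zero)) zero             = same-order-> xa<xc ≤-refl
    order (suc (suc zero)) (suc zero)       = same-order-≡ (sym xb≡xc) refl
    order (suc (suc zero)) (suc (suc zero)) = same-order-≡ refl refl

BHat⇔ : ∀ {n} (x : Vec ℕ n) → BHat n p122 x ⇔ (RevisedAscent122 (toList x) × All (_≤ n) (toList x))
BHat⇔ x = mk⇔
  (λ (((endo , values) , ascbot⇔nub) , avoids) → let pos , bounded = to (Endofunction⇔ x) endo in
     revised pos (to (Cayley-values⇔Gapless x) values) (to (Ascbot⇔Nub⇔AscbotIsNub x) ascbot⇔nub)
             (from (Avoids122⇔ x) (avoids ∘ from (Contains122⇔ x))) ,
     bounded)
  (λ (revised pos gap an av , bounded) →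
     ((from (Endofunction⇔ x) (pos , bounded) , from (Cayley-values⇔Gapless x) gap) ,
      from (Ascbot⇔Nub⇔AscbotIsNub x) an) ,
     to (Avoids122⇔ x) av ∘ to (Contains122⇔ x))

toList-subst-fromList : ∀ {A : Set} {n} (l : List A) (len : length l ≡ n) → toList (subst (Vec A) len (fromList l)) ≡ l
toList-subst-fromList l refl = toList∘fromList l

vectorise : ∀ {A : Set} {n} (G : List (List A)) → All (λ l → length l ≡ n) G → List (Vec A n)
vectorise [] []                 = []
vectorise (l ∷ G) (len ∷ lens) = subst (Vec _) len (fromList l) ∷ vectorise G lens

map-toList-vectorise : ∀ {A : Set} {n} G (lens : All (λ (l : List A) → length l ≡ n) G) →
                       map toList (vectorise G lens) ≡ G
map-toList-vectorise [] []                 = refl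
map-toList-vectorise (l ∷ G) (len ∷ lens) = cong₂ _∷_ (toList-subst-fromList l len) (map-toList-vectorise G lens)

HasCardinality-toList : ∀ {A : Set} {n} {P : Vec A n → Set} (G : List (List A)) → Unique G →
                        All (λ l → length l ≡ n) G → (∀ x → P x ⇔ toList x ∈ G) → HasCardinality P (length G)
HasCardinality-toList G unique lens P⇔∈ =
  V , Unique.map⁻ (subst Unique (sym toList-V) unique) , (λ x → ⇔-sym (P⇔∈ x) ⇔-∘ ∈V⇔ x) , length-V
  where
  V = vectorise G lens
  toList-V : map toList V ≡ G
  toList-V = map-toList-vectorise G lens
  ∈V⇔ : ∀ x → x ∈ V ⇔ toList x ∈ G
  ∈V⇔ x = mk⇔ (λ x∈V → subst (toList x ∈_) toList-V (∈-map⁺ toList x∈V)) λ x∈G →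
    let y , y∈V , same-list = ∈-map⁻ toList (subst (toList x ∈_) (sym toList-V) x∈G)
    in subst (_∈ V) (sym (trans (sym (cast-is-id refl x)) (toList-injective refl x y same-list))) y∈V
  length-V : length V ≡ length G
  length-V = trans (sym (List.length-map toList V)) (cong length toList-V)

mainTheorem4 : ∀ (n : ℕ) → 2 ≤ n → HasCardinality (BHat n p122) (2 ^ (n ∸ 2))
mainTheorem4 (suc (suc m)) (s≤s (s≤s z≤n)) =
  subst (HasCardinality (BHat (2 + m) p122)) (length-generate m)
    (HasCardinality-toList (generate m) (generate-unique m) lengths BHat⇔∈generate)
  where
  lengths : All (λ l → length l ≡ 2 + m) (generate m)
  lengths = All.tabulate λ l∈ → proj₁ (proj₂ (∈-generate⁻ m l∈))
  BHat⇔∈generate : ∀ x → BHat (2 + m) p122 x ⇔ toList x ∈ generate m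
  BHat⇔∈generate x = mk⇔
    (λ bhat → ∈-generate⁺ m (proj₁ (to (BHat⇔ x) bhat)) (length-toList x))
    (λ x∈ → let valid , _ , bounded = ∈-generate⁻ m x∈ in from (BHat⇔ x) (valid , bounded))
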